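{- In every algebraic language $L$ whose structural rules include weakening and contraction, the exchange rule is derivable: the term calculus consisting of the variable, function, substitution, unit and tensor rules together with weakening and contraction derives every sequent derivable when exchange is added.
   Context: Algebraic languages: fix a finitary many-sorted signature $\Sigma$ (atomic types; functional constants $f\colon B_1,\dots,B_n\to B_{n+1}$). Types are finite sequences of atomic types (juxtaposition; $\emptyset$ empty). Raw terms: $t::=\emptyset\mid x\mid f(t_1,\dots,t_n)\mid tt$, tensor associative with unit $\emptyset$; $t[s/x]$ is simultaneous substitution of $s=s_1\dots s_n$ for distinct atomic variables $x=x_1\dots x_n$. Sequents $x:A\vdash t:B$ with $x$ distinct atomic variables. Rules: Variables $x:A\vdash x:A$ ($x,A$ atomic); Functions: from $x_i:A_i\vdash t_i:B_i$ infer $x_1\dots x_n:A_1\dots A_n\vdash f(t_1,\dots,t_n):B_{n+1}$; Substitution: from $x:A\vdash s:B$, $y:B\vdash t:C$ infer $x:A\vdash t[s/y]:C$; Unit $\emptyset:\emptyset\vdash\emptyset:\emptyset$; Tensor: from $x:A\vdash s:B$, $y:C\vdash t:D$ infer $xy:AC\vdash st:BD$; Weakening: from $x_1x_3:A_1A_3\vdash t:B$ infer $x_1x_2x_3:A_1A_2A_3\vdash t:B$; Exchange: from $x:A\vdash t:B$ infer $\sigma x:\sigma A\vdash t:B$ for a permutation $\sigma$; Contraction: from $x_1xx'x_2:A_1AAA_2\vdash t:B$ infer $x_1xx_2:A_1AA_2\vdash t[x/x']:B$. An algebraic language is $\Sigma$ plus a subset of {weakening, exchange, contraction}. -}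

module Defs where

open import Data.Nat using (ℕ; _≡ᵇ_)
open import Data.Bool using (Bool; true; false; if_then_else_; T)
open import Data.List using (List; []; _∷_; _++_; map; concat; [_])
open import Data.Product using (_×_; _,_; proj₁; proj₂)
open import Data.List.Relation.Unary.Unique.Propositional using (Unique)
open import Data.List.Relation.Binary.Permutation.Propositional using (_↭_)
open import Relation.Binary.PropositionalEquality using (_≡_)

record Signature : Set₁ where
  field
    Sort : Set
    Fun  : Set
    dom  : Fun → List Sort
    cod  : Fun → Sort

Var : Set
Var = ℕ

-- Since tensor is associative with unit ∅, a raw term is a finite
-- sequence (list) of "atomic" terms: a variable x or f(t₁,…,tₙ).
-- ∅ is the empty list and tensor st is list concatenation.
data Atom (F : Set) : Set where
  var : Var → Atom F
  app : F → List (List (Atom F)) → Atom F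

Term : Set → Set
Term F = List (Atom F)

lookupSub : {F : Set} → List Var → List (Atom F) → Var → Atom F
lookupSub []       _        z = var z
lookupSub (y ∷ ys) []       z = var z
lookupSub (y ∷ ys) (s ∷ ss) z = if y ≡ᵇ z then s else lookupSub ys ss z

mutual
  substAtom : {F : Set} → List Var → List (Atom F) → Atom F → Atom F
  substAtom xs ss (var z)    = lookupSub xs ss z
  substAtom xs ss (app f ts) = app f (substArgs xs ss ts)

  substTerm : {F : Set} → List Var → List (Atom F) → Term F → Term F
  substTerm xs ss []       = []
  substTerm xs ss (a ∷ as) = substAtom xs ss a ∷ substTerm xs ss as

  substArgs : {F : Set} → List Var → List (Atom F) → List (Term F) → List (Term F)
  substArgs xs ss []       = []
  substArgs xs ss (t ∷ ts) = substTerm xs ss t ∷ substArgs xs ss ts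

record Rules : Set where
  constructor rules
  field
    weakening   : Bool
    exchange    : Bool
    contraction : Bool
open Rules public

module Calculus (Sig : Signature) (R : Rules) where
  open Signature Sig

  Type : Set
  Type = List Sort

  Ctx : Set
  Ctx = List (Var × Sort)

  vars : Ctx → List Var
  vars = map proj₁

  types : Ctx → Type
  types = map proj₂

  Tm : Set
  Tm = Term Fun

  infix 4 _⊢_∶_
  mutual
    data _⊢_∶_ : Ctx → Tm → Type → Set where
      var-rule : ∀ (x : Var) (A : Sort) → [ (x , A) ] ⊢ [ var x ] ∶ [ A ]
      function : ∀ (f : Fun) {Γs : List Ctx} {ts : List Tm} →
                 Args Γs ts (dom f) →
                 Unique (vars (concat Γs)) →
                 concat Γs ⊢ [ app f ts ] ∶ [ cod f ]
      substitution : ∀ {Γ s B Δ t C} →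
                 Γ ⊢ s ∶ B → Δ ⊢ t ∶ C → types Δ ≡ B →
                 Γ ⊢ substTerm (vars Δ) s t ∶ C
      unit : [] ⊢ [] ∶ []
      tensor : ∀ {Γ s B Δ t D} →
                 Γ ⊢ s ∶ B → Δ ⊢ t ∶ D → Unique (vars (Γ ++ Δ)) →
                 Γ ++ Δ ⊢ s ++ t ∶ B ++ D
      weakening-rule : ∀ {Γ₁ Γ₂ Γ₃ t B} → T (weakening R) →
                 Γ₁ ++ Γ₃ ⊢ t ∶ B → Unique (vars (Γ₁ ++ Γ₂ ++ Γ₃)) →
                 Γ₁ ++ Γ₂ ++ Γ₃ ⊢ t ∶ B
      exchange-rule : ∀ {Γ Γ' t B} → T (exchange R) →
                 Γ ⊢ t ∶ B → Γ ↭ Γ' → Γ' ⊢ t ∶ B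
      contraction-rule : ∀ {Γ₁ Δ Δ' Γ₂ t B} → T (contraction R) →
                 Γ₁ ++ Δ ++ Δ' ++ Γ₂ ⊢ t ∶ B → types Δ ≡ types Δ' →
                 Γ₁ ++ Δ ++ Γ₂ ⊢ substTerm (vars Δ') (map var (vars Δ)) t ∶ B

    data Args : List Ctx → List Tm → List Sort → Set where
      []  : Args [] [] []
      _∷_ : ∀ {Γ t A Γs ts As} → Γ ⊢ t ∶ [ A ] → Args Γs ts As →
            Args (Γ ∷ Γs) (t ∷ ts) (A ∷ As)

Derivable : (Sig : Signature) → Rules → List (Var × Signature.Sort Sig) →
            Term (Signature.Fun Sig) → List (Signature.Sort Sig) → Set
Derivable Sig R Γ t B = Calculus._⊢_∶_ Sig R Γ t B

-- Exchange is simulated by substitution: for a permutation Γ ↭ Γ' there is a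
-- derivation of Γ' ⊢ x : A, where x : A is the variable list of Γ, and
-- substituting it into Γ ⊢ t : B yields Γ' ⊢ t[x/x] : B, i.e. Γ' ⊢ t : B.
-- Such "permutation terms" are assembled along the inductive structure of ↭
-- by tensor and substitution from a single transposition y x : B A ⊢ x y : A B,
-- which in turn comes from weakening y x ⊢ x and y' x' ⊢ y' for fresh y', x',
-- tensoring them, and contracting y' x' into y x.
module Submission where

open import Defs
open import Data.Empty using (⊥-elim)
open import Data.Bool using (Bool; true; false; T)
open import Data.Nat using (zero; suc; _+_; _<_; _≡ᵇ_; s≤s)
open import Data.Nat.Properties
  using (≡ᵇ⇒≡; <⇒≢; <-trans; n<1+n; m≤m+n; m≤n+m)
open import Data.List using (List; []; _∷_; _++_; map; [_])
open import Data.Product using (_,_; proj₁)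
open import Data.List.Relation.Unary.All using ([]; _∷_)
open import Data.List.Relation.Unary.AllPairs using ([]; _∷_)
open import Data.List.Relation.Unary.Unique.Propositional using (Unique)
open import Data.List.Relation.Binary.Permutation.Propositional
  using (_↭_; refl; prep; swap; trans; ↭-sym; ↭⇒↭ₛ)
import Data.List.Relation.Binary.Permutation.Propositional.Properties as ↭
import Data.List.Relation.Binary.Permutation.Setoid.Properties as ↭ₛ
open import Data.List.Relation.Binary.Sublist.Propositional
  using (_⊆_; []; _∷ʳ_; _∷_; ⊆-refl)
import Data.List.Relation.Binary.Sublist.Propositional.Properties as ⊆
open import Relation.Binary.PropositionalEquality
  using (_≡_; _≢_; cong; cong₂; subst; sym; setoid; ≢-sym)
  renaming (refl to ≡-refl)

Unique-resp-↭ : ∀ {a} {A : Set a} {xs ys : List A} → xs ↭ ys → Unique xs → Unique ys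
Unique-resp-↭ {A = A} p = ↭ₛ.Unique-resp-↭ (setoid A) (↭⇒↭ₛ p)

Unique-resp-⊇ : ∀ {a} {A : Set a} {xs ys : List A} → xs ⊆ ys → Unique ys → Unique xs
Unique-resp-⊇ []           []       = []
Unique-resp-⊇ (_ ∷ʳ τ)     (_ ∷ u)  = Unique-resp-⊇ τ u
Unique-resp-⊇ (≡-refl ∷ τ) (px ∷ u) = ⊆.All-resp-⊆ τ px ∷ Unique-resp-⊇ τ u

≡ᵇ-refl : ∀ n → (n ≡ᵇ n) ≡ true
≡ᵇ-refl zero    = ≡-refl
≡ᵇ-refl (suc n) = ≡ᵇ-refl n

≢⇒≡ᵇ-false : ∀ {m n} → m ≢ n → (m ≡ᵇ n) ≡ false
≢⇒≡ᵇ-false {m} {n} m≢n with m ≡ᵇ n in eq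
... | false = ≡-refl
... | true  = ⊥-elim (m≢n (≡ᵇ⇒≡ m n (subst T (sym eq) _)))

module _ {F : Set} where

  lookupSub-id : ∀ xs z → lookupSub {F} xs (map var xs) z ≡ var z
  lookupSub-id []       z = ≡-refl
  lookupSub-id (y ∷ ys) z with y ≡ᵇ z in eq
  ... | true  = cong var (≡ᵇ⇒≡ y z (subst T (sym eq) _))
  ... | false = lookupSub-id ys z

  mutual
    substAtom-id : ∀ xs (a : Atom F) → substAtom xs (map var xs) a ≡ a
    substAtom-id xs (var z)    = lookupSub-id xs z
    substAtom-id xs (app f ts) = cong (app f) (substArgs-id xs ts)

    substTerm-id : ∀ xs (t : Term F) → substTerm xs (map var xs) t ≡ t
    substTerm-id xs []       = ≡-refl
    substTerm-id xs (a ∷ as) = cong₂ _∷_ (substAtom-id xs a) (substTerm-id xs as)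

    substArgs-id : ∀ xs (ts : List (Term F)) → substArgs xs (map var xs) ts ≡ ts
    substArgs-id xs []       = ≡-refl
    substArgs-id xs (t ∷ ts) = cong₂ _∷_ (substTerm-id xs t) (substArgs-id xs ts)

module Admissible (Sig : Signature) (R : Rules) where
  open Calculus Sig R

  ⊢-unique : ∀ {Γ t B} → Γ ⊢ t ∶ B → Unique (vars Γ)
  ⊢-unique (var-rule x A)           = [] ∷ []
  ⊢-unique (function f ds u)        = u
  ⊢-unique (substitution d e eq)    = ⊢-unique d
  ⊢-unique unit                     = []
  ⊢-unique (tensor d e u)           = u
  ⊢-unique (weakening-rule w d u)   = u
  ⊢-unique (exchange-rule w d p)    = Unique-resp-↭ (↭.map⁺ proj₁ p) (⊢-unique d)
  ⊢-unique (contraction-rule {Γ₁} {Δ} {Δ'} {Γ₂} c d eq) =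
    Unique-resp-⊇ (⊆.map⁺ proj₁ Γ₁ΔΓ₂⊆Γ₁ΔΔ'Γ₂) (⊢-unique d)
    where
      Γ₁ΔΓ₂⊆Γ₁ΔΔ'Γ₂ : Γ₁ ++ Δ ++ Γ₂ ⊆ Γ₁ ++ Δ ++ Δ' ++ Γ₂
      Γ₁ΔΓ₂⊆Γ₁ΔΔ'Γ₂ = ⊆.++⁺ (⊆-refl {x = Γ₁}) (⊆.++⁺ (⊆-refl {x = Δ}) (⊆.++⁺ˡ Δ' ⊆-refl))

  ⊢-cong : ∀ {Γ t t' B} → t ≡ t' → Γ ⊢ t ∶ B → Γ ⊢ t' ∶ B
  ⊢-cong {Γ} {B = B} = subst (λ s → Γ ⊢ s ∶ B)

  identity : ∀ Γ → Unique (vars Γ) → Γ ⊢ map var (vars Γ) ∶ types Γ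
  identity []            u          = unit
  identity ((x , A) ∷ Γ) u@(_ ∷ u') = tensor (var-rule x A) (identity Γ u') u

  rename : ∀ {Γ Γ' t B} → Γ' ⊢ map var (vars Γ) ∶ types Γ → Γ ⊢ t ∶ B → Γ' ⊢ t ∶ B
  rename {Γ} {t = t} ρ d = ⊢-cong (substTerm-id (vars Γ) t) (substitution ρ d ≡-refl)

  module _ (weak : T (weakening R)) (contr : T (contraction R)) where

    transposition : ∀ {x y} A B → x ≢ y →
                    (y , B) ∷ (x , A) ∷ [] ⊢ var x ∷ var y ∷ [] ∶ A ∷ B ∷ []
    transposition {x} {y} A B x≢y =
      ⊢-cong contracted
        (contraction-rule {Γ₁ = []} {Δ = (y , B) ∷ (x , A) ∷ []} {Γ₂ = []} contr
           (tensor yx⊢x y'x'⊢y' distinct) ≡-refl)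
      where
        x' y' : Var
        x' = suc (x + y)
        y' = suc x'

        x<x' : x < x'
        x<x' = s≤s (m≤m+n x y)
        y<x' : y < x'
        y<x' = s≤s (m≤n+m y x)
        x'<y' : x' < y'
        x'<y' = n<1+n x'

        yx⊢x : (y , B) ∷ (x , A) ∷ [] ⊢ [ var x ] ∶ [ A ]
        yx⊢x = weakening-rule {Γ₁ = []} {Γ₂ = [ (y , B) ]} weak (var-rule x A)
                 ((≢-sym x≢y ∷ []) ∷ [] ∷ [])

        y'x'⊢y' : (y' , B) ∷ (x' , A) ∷ [] ⊢ [ var y' ] ∶ [ B ]
        y'x'⊢y' = weakening-rule {Γ₁ = [ (y' , B) ]} {Γ₃ = []} weak (var-rule y' B)
                    ((≢-sym (<⇒≢ x'<y') ∷ []) ∷ [] ∷ [])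

        distinct : Unique (y ∷ x ∷ y' ∷ x' ∷ [])
        distinct = (≢-sym x≢y ∷ <⇒≢ (<-trans y<x' x'<y') ∷ <⇒≢ y<x' ∷ [])
                 ∷ (<⇒≢ (<-trans x<x' x'<y') ∷ <⇒≢ x<x' ∷ [])
                 ∷ (≢-sym (<⇒≢ x'<y') ∷ [])
                 ∷ [] ∷ []

        contracted : substTerm (y' ∷ x' ∷ []) (var y ∷ var x ∷ []) (var x ∷ var y' ∷ [])
                     ≡ var x ∷ var y ∷ []
        contracted rewrite ≢⇒≡ᵇ-false (≢-sym (<⇒≢ (<-trans x<x' x'<y')))
                         | ≢⇒≡ᵇ-false (≢-sym (<⇒≢ x<x'))
                         | ≡ᵇ-refl y' = ≡-refl

    permutation : ∀ {Γ Γ'} → Γ ↭ Γ' → Unique (vars Γ') → Γ' ⊢ map var (vars Γ) ∶ types Γ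
    permutation {Γ} refl u                  = identity Γ u
    permutation (prep (x , A) p) u@(_ ∷ u') = tensor (var-rule x A) (permutation p u') u
    permutation (swap (x , A) (y , B) p) u@((y≢x ∷ _) ∷ _ ∷ u') =
      tensor (transposition A B (≢-sym y≢x)) (permutation p u') u
    permutation (trans p q) u =
      rename (permutation q u) (permutation p (Unique-resp-↭ (↭-sym (↭.map⁺ proj₁ q)) u))

    exchange-admissible : ∀ {Γ Γ' t B} → Γ ⊢ t ∶ B → Γ ↭ Γ' → Γ' ⊢ t ∶ B
    exchange-admissible d p =
      rename (permutation p (Unique-resp-↭ (↭.map⁺ proj₁ p) (⊢-unique d))) d

module _ (Sig : Signature) {w e c : Bool} (weak : T w) (contr : T c) where
  private
    module From = Calculus Sig (rules w e c)
  open Calculus Sig (rules w false c)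
  open Admissible Sig (rules w false c)

  mutual
    eliminate-exchange : ∀ {Γ t B} → Γ From.⊢ t ∶ B → Γ ⊢ t ∶ B
    eliminate-exchange (From.var-rule x A)    = var-rule x A
    eliminate-exchange (From.function f ds u) = function f (eliminate-exchange* ds) u
    eliminate-exchange From.unit              = unit
    eliminate-exchange (From.substitution d₁ d₂ eq) =
      substitution (eliminate-exchange d₁) (eliminate-exchange d₂) eq
    eliminate-exchange (From.tensor d₁ d₂ u) =
      tensor (eliminate-exchange d₁) (eliminate-exchange d₂) u
    eliminate-exchange (From.weakening-rule {Γ₁} {Γ₂} {Γ₃} _ d u) =
      weakening-rule {Γ₁ = Γ₁} {Γ₂ = Γ₂} {Γ₃ = Γ₃} weak (eliminate-exchange d) u
    eliminate-exchange (From.exchange-rule _ d p) =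
      exchange-admissible weak contr (eliminate-exchange d) p
    eliminate-exchange (From.contraction-rule {Γ₁} {Δ} {Δ'} {Γ₂} _ d eq) =
      contraction-rule {Γ₁ = Γ₁} {Δ = Δ} {Δ' = Δ'} {Γ₂ = Γ₂} contr (eliminate-exchange d) eq

    eliminate-exchange* : ∀ {Γs ts As} → From.Args Γs ts As → Args Γs ts As
    eliminate-exchange* From.[]       = []
    eliminate-exchange* (d From.∷ ds) = eliminate-exchange d ∷ eliminate-exchange* ds

corollary5p5 : (Sig : Signature) (R : Rules) →
    T (weakening R) → T (contraction R) →
    ∀ Γ t B →
    Derivable Sig (rules (weakening R) true (contraction R)) Γ t B →
    Derivable Sig (rules (weakening R) false (contraction R)) Γ t B
corollary5p5 Sig R weak contr Γ t B = eliminate-exchange Sig weak contr
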